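{- Let $p$ be an odd prime and let $b_0,b_1,b_2,\ldots\in\mathbb{Q}_p$. Define $B_0=1$, $B_1=b_1$ and $B_n=b_nB_{n-1}+B_{n-2}$ for $n\geq 2$. Then the following are equivalent: (i) $v_p(b_{n+1}B_{n})<v_p(B_{n-1})$ for all $n\geq 1$; (ii) $v_p(b_nb_{n+1})<0$ for all $n\geq 1$.
   Context: $v_p$ denotes the $p$-adic valuation on $\mathbb{Q}_p$. The $B_n$ are the denominators of the convergents $A_n/B_n$ of the continued fraction $[b_0,b_1,b_2,\ldots]=b_0+\cfrac{1}{b_1+\cfrac{1}{b_2+\cdots}}$. -}

module Defs where

open import Data.Nat using (ℕ; zero; suc; _+_; _*_; _∸_; _/_; _<ᵇ_; _≡ᵇ_; NonZero)
open import Data.Nat.DivMod using (_mod_)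
open import Data.Fin using (Fin; toℕ)
open import Data.Bool using (if_then_else_)
open import Data.List using (map; upTo)
open import Data.Nat.ListAction using (sum)
open import Data.Integer using (ℤ; +_; _-_) renaming (_<_ to _<ℤ_)
open import Data.Product using (∃-syntax; _×_)
open import Relation.Binary.PropositionalEquality using (_≡_; _≢_)

-- A p-adic number, represented as  p^(-shift) * (Σ_{i ≥ 0} digit i * p^i),
-- i.e.  x = Σ_i digit i * p^(i - shift)  with digits in {0,…,p-1}.
-- Every element of ℚ_p has such a representation (non-unique only through
-- padding: shift+1 with digits shifted up by one is the same number).
record ℚₚ (p : ℕ) : Set where
  constructor mkℚₚ
  field
    shift : ℕ
    digit : ℕ → Fin p

open ℚₚ public

module _ {p : ℕ} .{{_ : NonZero p}} where

  -- carries when normalising a p-adic integer Σ_i s i * p^i (s i ∈ ℕ)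
  carry : (ℕ → ℕ) → ℕ → ℕ
  carry s zero    = 0
  carry s (suc n) = (s n + carry s n) / p

  normalize : (ℕ → ℕ) → ℕ → Fin p
  normalize s n = (s n + carry s n) mod p

  shiftUp : ℕ → (ℕ → Fin p) → ℕ → ℕ
  shiftUp l z i = if i <ᵇ l then 0 else toℕ (z (i ∸ l))

  conv : (ℕ → Fin p) → (ℕ → Fin p) → ℕ → ℕ
  conv a b n = sum (map (λ i → toℕ (a i) * toℕ (b (n ∸ i))) (upTo (suc n)))

  infixl 6 _+ₚ_
  infixl 7 _*ₚ_

  _+ₚ_ : ℚₚ p → ℚₚ p → ℚₚ p
  x +ₚ y = mkℚₚ (shift x + shift y)
                (normalize (λ i → shiftUp (shift y) (digit x) i + shiftUp (shift x) (digit y) i))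

  _*ₚ_ : ℚₚ p → ℚₚ p → ℚₚ p
  x *ₚ y = mkℚₚ (shift x + shift y) (normalize (conv (digit x) (digit y)))

  oneₚ : ℚₚ p
  oneₚ = mkℚₚ 0 (normalize (λ i → if i ≡ᵇ 0 then 1 else 0))

  B : (ℕ → ℚₚ p) → ℕ → ℚₚ p
  B b zero          = oneₚ
  B b (suc zero)    = b 1
  B b (suc (suc n)) = b (suc (suc n)) *ₚ B b (suc n) +ₚ B b n

  expo : ℚₚ p → ℕ → ℤ
  expo x i = + i - + shift x

  -- v_p(x) < m   (false when x = 0, since v_p(0) = ∞)
  vLt : ℚₚ p → ℤ → Set
  vLt x m = ∃[ i ] (expo x i <ℤ m × toℕ (digit x i) ≢ 0)

  -- v_p(x) ≥ m   (true for all m when x = 0)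
  vGe : ℚₚ p → ℤ → Set
  vGe x m = ∀ i → expo x i <ℤ m → toℕ (digit x i) ≡ 0

  -- v_p(x) < v_p(y)  (with v_p(0) = ∞)
  vLtv : ℚₚ p → ℚₚ p → Set
  vLtv x y = ∃[ m ] (vLt x m × vGe y m)

-- For nonzero x, v(x) is the exponent of the first nonzero digit; v(xy) = v(x) + v(y) because p is
-- prime, and v(x + y) = v(x) whenever v(x) < v(y).  Call m dominant when b_{m+1}, b_{m+2}, B_m, B_{m+1}
-- are nonzero, v(B_{m+1}) = v(b_{m+1}) + v(B_m) and v(b_{m+2} B_{m+1}) < v(B_m).  Then the ultrametric
-- rule gives v(B_{m+2}) = v(b_{m+2}) + v(B_{m+1}), so dominance of m + 1 amounts to
-- v(b_{m+3}) + v(b_{m+2}) + v(B_{m+1}) < v(B_{m+1}), which is equivalent both to condition (i) and to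
-- condition (ii) at m + 2.  Thus either condition makes every m dominant by induction, and dominance
-- of every m gives back both conditions.
module Submission where

open import Defs
open import Data.Nat
  using (ℕ; zero; suc; _+_; _*_; _∸_; _%_; _≤_; _<_; _≥_; z≤n; s≤s; s≤s⁻¹; _<ᵇ_; _≟_; _<?_; NonZero; nonTrivial⇒≢1)
open import Data.Nat.Properties
  using (≤-refl; ≤-trans; <⇒≤; m≤n⇒m≤1+n; <-cmp; <-irrefl; ≮⇒≥; ≤∧≢⇒<; ≤⇒≯; m<1+n⇒m<n∨m≡n; +-identityʳ; *-zeroʳ;
         m≤m+n; m≤n+m; m+n∸n≡m; m+n∸m≡n; m∸n+n≡m; ∸-monoˡ-<; ∸-monoʳ-<; ∸-monoʳ-≤; <⇒<ᵇ; <ᵇ⇒<; module ≤-Reasoning)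
open import Data.Nat.DivMod using (0/n≡0; m<n⇒m%n≡m)
open import Data.Nat.Divisibility using (_∣_; _∣0; ∣1⇒≡1; m%n≡0⇒n∣m; n∣m⇒m%n≡0)
open import Data.Nat.Primality using (Prime; euclidsLemma; prime⇒nonTrivial)
open import Data.Nat.ListAction using (sum)
open import Data.Nat.ListAction.Properties using (sum-++)
open import Data.Integer as ℤ using (ℤ; +_; 0ℤ)
import Data.Integer.Properties as ℤ
open import Data.Integer.Tactic.RingSolver using (solve-∀)
open import Data.Fin using (Fin; toℕ)
open import Data.Fin.Properties using (toℕ<n; toℕ-fromℕ<)
open import Data.List using (map; upTo; _++_; [_])
open import Data.List.Properties using (upTo-∷ʳ; map-++)
open import Data.Product using (Σ-syntax; _×_; _,_)
open import Data.Sum using (_⊎_; inj₁; inj₂)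
open import Data.Bool using (true; false)
open import Data.Unit using (tt)
open import Function using (_∘_)
open import Function.Bundles using (_⇔_; mk⇔)
open import Relation.Nullary using (¬_; yes; no; contradiction)
open import Relation.Binary using (tri<; tri≈; tri>)
open import Relation.Binary.PropositionalEquality
  using (_≡_; _≢_; refl; sym; trans; cong; cong₂; subst; module ≡-Reasoning)

VanishesBelow : (ℕ → ℕ) → ℕ → Set
VanishesBelow f i = ∀ j → j < i → f j ≡ 0

FirstNonZero : (ℕ → ℕ) → ℕ → Set
FirstNonZero f i = f i ≢ 0 × VanishesBelow f i

sum-upTo-suc : ∀ (f : ℕ → ℕ) m → sum (map f (upTo (suc m))) ≡ sum (map f (upTo m)) + f m
sum-upTo-suc f m = begin
  sum (map f (upTo (suc m)))       ≡⟨ cong (sum ∘ map f) (sym (upTo-∷ʳ m)) ⟩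
  sum (map f (upTo m ++ [ m ]))    ≡⟨ cong sum (map-++ f (upTo m) [ m ]) ⟩
  sum (map f (upTo m) ++ [ f m ])  ≡⟨ sum-++ (map f (upTo m)) [ f m ] ⟩
  sum (map f (upTo m)) + (f m + 0) ≡⟨ cong₂ _+_ refl (+-identityʳ (f m)) ⟩
  sum (map f (upTo m)) + f m       ∎
  where open ≡-Reasoning

sum-upTo-vanishing : ∀ f m → VanishesBelow f m → sum (map f (upTo m)) ≡ 0
sum-upTo-vanishing f zero    _ = refl
sum-upTo-vanishing f (suc m) f≡0 = trans (sum-upTo-suc f m)
  (cong₂ _+_ (sum-upTo-vanishing f m (λ t t<m → f≡0 t (m≤n⇒m≤1+n t<m))) (f≡0 m ≤-refl))

sum-upTo-single : ∀ f m i → i < m → (∀ t → t < m → t ≢ i → f t ≡ 0) → sum (map f (upTo m)) ≡ f i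
sum-upTo-single f (suc m) i i<1+m others with i ≟ m
... | yes refl = trans (sum-upTo-suc f i)
  (cong (_+ f i) (sum-upTo-vanishing f i (λ t t<i → others t (m≤n⇒m≤1+n t<i) λ { refl → <-irrefl refl t<i })))
... | no i≢m = begin
  sum (map f (upTo (suc m)))   ≡⟨ sum-upTo-suc f m ⟩
  sum (map f (upTo m)) + f m   ≡⟨ cong₂ _+_ (sum-upTo-single f m i (≤∧≢⇒< (s≤s⁻¹ i<1+m) i≢m) below) (others m ≤-refl (i≢m ∘ sym)) ⟩
  f i + 0                      ≡⟨ +-identityʳ (f i) ⟩
  f i                          ∎
  where
  open ≡-Reasoning
  below : ∀ t → t < m → t ≢ i → f t ≡ 0
  below t t<m = others t (m≤n⇒m≤1+n t<m)

firstNonZero-unique : ∀ {f i j} → FirstNonZero f i → FirstNonZero f j → i ≡ j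
firstNonZero-unique {i = i} {j} (fi≢0 , below-i) (fj≢0 , below-j) with <-cmp i j
... | tri< i<j _ _ = contradiction (below-j i i<j) fi≢0
... | tri≈ _ i≡j _ = i≡j
... | tri> _ _ j<i = contradiction (below-i j j<i) fj≢0

firstNonZero-below? : ∀ f n → VanishesBelow f n ⊎ Σ[ i ∈ ℕ ] (i < n × FirstNonZero f i)
firstNonZero-below? f zero = inj₁ λ _ ()
firstNonZero-below? f (suc n) with firstNonZero-below? f n
... | inj₂ (i , i<n , first) = inj₂ (i , m≤n⇒m≤1+n i<n , first)
... | inj₁ below with f n ≟ 0
...   | no fn≢0  = inj₂ (n , ≤-refl , fn≢0 , below)
...   | yes fn≡0 = inj₁ below′
  where
  below′ : VanishesBelow f (suc n)
  below′ j j<1+n with m<1+n⇒m<n∨m≡n j<1+n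
  ... | inj₁ j<n  = below j j<n
  ... | inj₂ refl = fn≡0

i+j<j⇒i<0 : ∀ {i j} → i ℤ.+ j ℤ.< j → i ℤ.< 0ℤ
i+j<j⇒i<0 {i} {j} i+j<j with i ℤ.<? 0ℤ
... | yes i<0 = i<0
... | no  i≮0 = contradiction i+j<j (ℤ.≤⇒≯ (subst (ℤ._≤ i ℤ.+ j) (ℤ.+-identityˡ j) (ℤ.+-monoˡ-≤ j (ℤ.≮⇒≥ i≮0))))

i<0⇒i+j<j : ∀ {i j} → i ℤ.< 0ℤ → i ℤ.+ j ℤ.< j
i<0⇒i+j<j {i} {j} i<0 = subst (i ℤ.+ j ℤ.<_) (ℤ.+-identityˡ j) (ℤ.+-monoˡ-< j i<0)

module _ {p : ℕ} .{{_ : NonZero p}} where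

  digits : ℚₚ p → ℕ → ℕ
  digits x = toℕ ∘ digit x

  digit-divisible⇒≡0 : (d : Fin p) → p ∣ toℕ d → toℕ d ≡ 0
  digit-divisible⇒≡0 d p∣d = trans (sym (m<n⇒m%n≡m (toℕ<n d))) (n∣m⇒m%n≡0 (toℕ d) p p∣d)

  carry-vanishing : ∀ {s i} → VanishesBelow s i → ∀ j → j ≤ i → carry s j ≡ 0
  carry-vanishing s≡0 zero    _   = refl
  carry-vanishing s≡0 (suc j) j<i rewrite s≡0 j j<i | carry-vanishing s≡0 j (<⇒≤ j<i) = 0/n≡0 p

  toℕ-normalize : ∀ s j → toℕ (normalize s j) ≡ (s j + carry s j) % p
  toℕ-normalize s j = toℕ-fromℕ< _

  normalize-vanishing : ∀ {s i} → VanishesBelow s i → VanishesBelow (toℕ ∘ normalize s) i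
  normalize-vanishing {s} s≡0 j j<i
    rewrite toℕ-normalize s j | s≡0 j j<i | carry-vanishing s≡0 j (<⇒≤ j<i) = n∣m⇒m%n≡0 0 p (p ∣0)

  normalize-first : ∀ {s i} → VanishesBelow s i → ¬ (p ∣ s i) → FirstNonZero (toℕ ∘ normalize s) i
  normalize-first {s} {i} s≡0 p∤si = nonzero , normalize-vanishing s≡0
    where
    nonzero : toℕ (normalize s i) ≢ 0
    nonzero si%p≡0 rewrite toℕ-normalize s i | carry-vanishing s≡0 i ≤-refl | +-identityʳ (s i) =
      p∤si (m%n≡0⇒n∣m (s i) p si%p≡0)

  shiftUp-below : ∀ l z t → t < l → shiftUp l z t ≡ 0
  shiftUp-below l z t t<l with t <ᵇ l | <⇒<ᵇ t<l
  ... | true | _ = refl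

  shiftUp-above : ∀ l z t → l ≤ t → shiftUp l z t ≡ toℕ (z (t ∸ l))
  shiftUp-above l z t l≤t with t <ᵇ l | <ᵇ⇒< t l
  ... | true  | t<l = contradiction (t<l tt) (≤⇒≯ l≤t)
  ... | false | _   = refl

  shiftUp-≡0 : ∀ l z t → (l ≤ t → toℕ (z (t ∸ l)) ≡ 0) → shiftUp l z t ≡ 0
  shiftUp-≡0 l z t z≡0 with t <? l
  ... | yes t<l = shiftUp-below l z t t<l
  ... | no  t≮l = trans (shiftUp-above l z t (≮⇒≥ t≮l)) (z≡0 (≮⇒≥ t≮l))

  conv-vanishing : ∀ {a b : ℕ → Fin p} {i i′} → VanishesBelow (toℕ ∘ a) i → VanishesBelow (toℕ ∘ b) i′ →
                   VanishesBelow (conv a b) (i + i′)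
  conv-vanishing {a} {b} {i} {i′} a≡0 b≡0 j j<i+i′ = sum-upTo-vanishing _ (suc j) term≡0
    where
    term≡0 : ∀ t → t < suc j → toℕ (a t) * toℕ (b (j ∸ t)) ≡ 0
    term≡0 t t≤j with t <? i
    ... | yes t<i = cong (_* toℕ (b (j ∸ t))) (a≡0 t t<i)
    ... | no  t≮i = trans (cong (toℕ (a t) *_) (b≡0 (j ∸ t) j∸t<i′)) (*-zeroʳ (toℕ (a t)))
      where
      i≤t : i ≤ t
      i≤t = ≮⇒≥ t≮i
      j∸t<i′ : j ∸ t < i′
      j∸t<i′ = begin-strict
        j ∸ t       ≤⟨ ∸-monoʳ-≤ j i≤t ⟩
        j ∸ i       <⟨ ∸-monoˡ-< j<i+i′ (≤-trans i≤t (s≤s⁻¹ t≤j)) ⟩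
        i + i′ ∸ i  ≡⟨ m+n∸m≡n i i′ ⟩
        i′          ∎
        where open ≤-Reasoning

  conv-at : ∀ {a b : ℕ → Fin p} {i i′} → VanishesBelow (toℕ ∘ a) i → VanishesBelow (toℕ ∘ b) i′ →
            conv a b (i + i′) ≡ toℕ (a i) * toℕ (b i′)
  conv-at {a} {b} {i} {i′} a≡0 b≡0 =
    trans (sum-upTo-single _ (suc (i + i′)) i (s≤s (m≤m+n i i′)) others)
          (cong (λ u → toℕ (a i) * toℕ (b u)) (m+n∸m≡n i i′))
    where
    others : ∀ t → t < suc (i + i′) → t ≢ i → toℕ (a t) * toℕ (b (i + i′ ∸ t)) ≡ 0
    others t t≤i+i′ t≢i with <-cmp t i
    ... | tri< t<i _ _ = cong (_* toℕ (b (i + i′ ∸ t))) (a≡0 t t<i)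
    ... | tri≈ _ t≡i _ = contradiction t≡i t≢i
    ... | tri> _ _ i<t = trans (cong (toℕ (a t) *_) (b≡0 (i + i′ ∸ t) i+i′∸t<i′)) (*-zeroʳ (toℕ (a t)))
      where
      i+i′∸t<i′ : i + i′ ∸ t < i′
      i+i′∸t<i′ = subst (i + i′ ∸ t <_) (m+n∸m≡n i i′) (∸-monoʳ-< i<t (s≤s⁻¹ t≤i+i′))

  expo-mono-≤ : ∀ x {i j} → i ≤ j → expo x i ℤ.≤ expo x j
  expo-mono-≤ x i≤j = ℤ.+-monoˡ-≤ (ℤ.- + shift x) (ℤ.+≤+ i≤j)

  expo-cancel-< : ∀ x {i j} → expo x i ℤ.< expo x j → i < j
  expo-cancel-< x {i} {j} xi<xj with i <? j
  ... | yes i<j = i<j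
  ... | no  i≮j = contradiction xi<xj (ℤ.≤⇒≯ (expo-mono-≤ x (≮⇒≥ i≮j)))

  expo-*ₚ : ∀ x y i j → expo (x *ₚ y) (i + j) ≡ expo x i ℤ.+ expo y j
  expo-*ₚ x y i j rewrite ℤ.pos-+ i j | ℤ.pos-+ (shift x) (shift y) =
    interchange (+ i) (+ j) (+ shift x) (+ shift y)
    where
    interchange : ∀ a b c d → (a ℤ.+ b) ℤ.- (c ℤ.+ d) ≡ (a ℤ.- c) ℤ.+ (b ℤ.- d)
    interchange = solve-∀

  expo-+ₚˡ : ∀ x y i → expo (x +ₚ y) (i + shift y) ≡ expo x i
  expo-+ₚˡ x y i rewrite ℤ.pos-+ i (shift y) | ℤ.pos-+ (shift x) (shift y) =
    cancel (+ i) (+ shift x) (+ shift y)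
    where
    cancel : ∀ a c d → (a ℤ.+ d) ℤ.- (c ℤ.+ d) ≡ a ℤ.- c
    cancel = solve-∀

  expo-+ₚʳ : ∀ x y i → expo (x +ₚ y) (i + shift x) ≡ expo y i
  expo-+ₚʳ x y i rewrite ℤ.pos-+ i (shift x) | ℤ.pos-+ (shift x) (shift y) =
    cancel (+ i) (+ shift x) (+ shift y)
    where
    cancel : ∀ a c d → (a ℤ.+ c) ℤ.- (c ℤ.+ d) ≡ a ℤ.- d
    cancel = solve-∀

  record HasVal (x : ℚₚ p) (k : ℤ) : Set where
    constructor hasVal
    field
      leading       : ℕ
      leading-first : FirstNonZero (digits x) leading
      leading-expo  : expo x leading ≡ k

  hasVal-unique : ∀ {x k l} → HasVal x k → HasVal x l → k ≡ l
  hasVal-unique {x} (hasVal i first-i refl) (hasVal j first-j refl) = cong (expo x) (firstNonZero-unique first-i first-j)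

  hasVal⇒vLt : ∀ {x k m} → HasVal x k → k ℤ.< m → vLt x m
  hasVal⇒vLt (hasVal i (xi≢0 , _) refl) k<m = i , k<m , xi≢0

  hasVal⇒vGe : ∀ {x k} → HasVal x k → vGe x k
  hasVal⇒vGe {x} (hasVal i (_ , below) refl) j xj<xi = below j (expo-cancel-< x xj<xi)

  vGe∧hasVal⇒≤ : ∀ {x m k} → vGe x m → HasVal x k → m ℤ.≤ k
  vGe∧hasVal⇒≤ {x} {m} x≥m (hasVal i (xi≢0 , _) refl) with m ℤ.≤? expo x i
  ... | yes m≤k = m≤k
  ... | no  m≰k = contradiction (x≥m i (ℤ.≰⇒> m≰k)) xi≢0

  hasVal-of-digit : ∀ x {i} → digits x i ≢ 0 → Σ[ k ∈ ℤ ] (HasVal x k × k ℤ.≤ expo x i)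
  hasVal-of-digit x {i} xi≢0 with firstNonZero-below? (digits x) (suc i)
  ... | inj₁ below                = contradiction (below i ≤-refl) xi≢0
  ... | inj₂ (i₀ , i₀<1+i , first) = expo x i₀ , hasVal i₀ first refl , expo-mono-≤ x (s≤s⁻¹ i₀<1+i)

  vLt⇒hasVal : ∀ {x m} → vLt x m → Σ[ k ∈ ℤ ] (HasVal x k × k ℤ.< m)
  vLt⇒hasVal {x} (i , xi<m , xi≢0) with hasVal-of-digit x xi≢0
  ... | k , x≈k , k≤xi = k , x≈k , ℤ.≤-<-trans k≤xi xi<m

  hasVal-*ₚ : Prime p → ∀ {x y k l} → HasVal x k → HasVal y l → HasVal (x *ₚ y) (k ℤ.+ l)
  hasVal-*ₚ p-prime {x} {y} (hasVal i (xi≢0 , x≡0) refl) (hasVal j (yj≢0 , y≡0) refl) =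
    hasVal (i + j) (normalize-first (conv-vanishing x≡0 y≡0) p∤xiyj) (expo-*ₚ x y i j)
    where
    p∤xiyj : ¬ (p ∣ conv (digit x) (digit y) (i + j))
    p∤xiyj p∣ with euclidsLemma (digits x i) (digits y j) p-prime (subst (p ∣_) (conv-at x≡0 y≡0) p∣)
    ... | inj₁ p∣xi = xi≢0 (digit-divisible⇒≡0 (digit x i) p∣xi)
    ... | inj₂ p∣yj = yj≢0 (digit-divisible⇒≡0 (digit y j) p∣yj)

  *ₚ-digit≢0⇒hasValˡ : ∀ x y {n} → digits (x *ₚ y) n ≢ 0 → Σ[ k ∈ ℤ ] HasVal x k
  *ₚ-digit≢0⇒hasValˡ x y {n} xyn≢0 with firstNonZero-below? (digits x) (suc n)
  ... | inj₁ below = contradiction (normalize-vanishing (conv-vanishing below (λ _ ())) n (s≤s (m≤m+n n 0))) xyn≢0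
  ... | inj₂ (i , _ , first) = expo x i , hasVal i first refl

  *ₚ-digit≢0⇒hasValʳ : ∀ x y {n} → digits (x *ₚ y) n ≢ 0 → Σ[ k ∈ ℤ ] HasVal y k
  *ₚ-digit≢0⇒hasValʳ x y {n} xyn≢0 with firstNonZero-below? (digits y) (suc n)
  ... | inj₁ below = contradiction (normalize-vanishing (conv-vanishing {a = digit x} {i = 0} (λ _ ()) below) n ≤-refl) xyn≢0
  ... | inj₂ (i , _ , first) = expo y i , hasVal i first refl

  hasVal-*ₚ-factors : Prime p → ∀ x y {k} → HasVal (x *ₚ y) k →
                      Σ[ c ∈ ℤ ] Σ[ d ∈ ℤ ] (HasVal x c × HasVal y d × k ≡ c ℤ.+ d)
  hasVal-*ₚ-factors p-prime x y xy≈k@(hasVal _ (xyn≢0 , _) _)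
    with *ₚ-digit≢0⇒hasValˡ x y xyn≢0 | *ₚ-digit≢0⇒hasValʳ x y xyn≢0
  ... | c , x≈c | d , y≈d = c , d , x≈c , y≈d , hasVal-unique xy≈k (hasVal-*ₚ p-prime x≈c y≈d)

  vLt-*ₚ : Prime p → ∀ x y {m} → vLt (x *ₚ y) m →
           Σ[ c ∈ ℤ ] Σ[ d ∈ ℤ ] (HasVal x c × HasVal y d × c ℤ.+ d ℤ.< m)
  vLt-*ₚ p-prime x y xy<m with vLt⇒hasVal xy<m
  ... | k , xy≈k , k<m with hasVal-*ₚ-factors p-prime x y xy≈k
  ...   | c , d , x≈c , y≈d , refl = c , d , x≈c , y≈d , k<m

  vLtv-*ₚ : Prime p → ∀ x y {z l} → vLtv (x *ₚ y) z → HasVal z l →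
            Σ[ c ∈ ℤ ] Σ[ d ∈ ℤ ] (HasVal x c × HasVal y d × c ℤ.+ d ℤ.< l)
  vLtv-*ₚ p-prime x y (m , xy<m , z≥m) z≈l with vLt-*ₚ p-prime x y xy<m
  ... | c , d , x≈c , y≈d , c+d<m = c , d , x≈c , y≈d , ℤ.<-≤-trans c+d<m (vGe∧hasVal⇒≤ z≥m z≈l)

  hasVal-+ₚ-dominant : ∀ {x y k m} → HasVal x k → vGe y m → k ℤ.< m → HasVal (x +ₚ y) k
  hasVal-+ₚ-dominant {x} {y} {k} {m} (hasVal i (xi≢0 , x≡0) refl) y≥m k<m =
    hasVal (i + shift y) (normalize-first s≡0 p∤s) (expo-+ₚˡ x y i)
    where
    s : ℕ → ℕ
    s t = shiftUp (shift y) (digit x) t + shiftUp (shift x) (digit y) t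

    y-part≡0 : ∀ t → t ≤ i + shift y → shiftUp (shift x) (digit y) t ≡ 0
    y-part≡0 t t≤ = shiftUp-≡0 (shift x) (digit y) t λ sx≤t → y≥m (t ∸ shift x) (begin-strict
      expo y (t ∸ shift x)                  ≡⟨ sym (expo-+ₚʳ x y (t ∸ shift x)) ⟩
      expo (x +ₚ y) (t ∸ shift x + shift x) ≡⟨ cong (expo (x +ₚ y)) (m∸n+n≡m sx≤t) ⟩
      expo (x +ₚ y) t                       ≤⟨ expo-mono-≤ (x +ₚ y) t≤ ⟩
      expo (x +ₚ y) (i + shift y)           ≡⟨ expo-+ₚˡ x y i ⟩
      expo x i                              <⟨ k<m ⟩
      m                                     ∎)
      where open ℤ.≤-Reasoning

    x-part≡0 : ∀ t → t < i + shift y → shiftUp (shift y) (digit x) t ≡ 0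
    x-part≡0 t t< = shiftUp-≡0 (shift y) (digit x) t λ sy≤t →
      x≡0 (t ∸ shift y) (subst (t ∸ shift y <_) (m+n∸n≡m i (shift y)) (∸-monoˡ-< t< sy≤t))

    s≡0 : VanishesBelow s (i + shift y)
    s≡0 t t< = cong₂ _+_ (x-part≡0 t t<) (y-part≡0 t (<⇒≤ t<))

    s≡xi : s (i + shift y) ≡ digits x i
    s≡xi = begin
      s (i + shift y)                       ≡⟨ cong₂ _+_ (shiftUp-above (shift y) (digit x) (i + shift y) (m≤n+m (shift y) i))
                                                         (y-part≡0 (i + shift y) ≤-refl) ⟩
      digits x (i + shift y ∸ shift y) + 0  ≡⟨ +-identityʳ _ ⟩
      digits x (i + shift y ∸ shift y)      ≡⟨ cong (digits x) (m+n∸n≡m i (shift y)) ⟩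
      digits x i                            ∎
      where open ≡-Reasoning

    p∤s : ¬ (p ∣ s (i + shift y))
    p∤s p∣ = xi≢0 (digit-divisible⇒≡0 (digit x i) (subst (p ∣_) s≡xi p∣))

  hasVal-one : Prime p → HasVal oneₚ 0ℤ
  hasVal-one p-prime = hasVal 0 (normalize-first (λ _ ()) p∤1) refl
    where
    p∤1 : ¬ (p ∣ 1)
    p∤1 p∣1 = nonTrivial⇒≢1 {{prime⇒nonTrivial p-prime}} (∣1⇒≡1 p∣1)

module Continuants {p : ℕ} .{{_ : NonZero p}} (p-prime : Prime p) (b : ℕ → ℚₚ p) where

  ConditionI : Set
  ConditionI = (n : ℕ) → n ≥ 1 → vLtv (b (suc n) *ₚ B b n) (B b (n ∸ 1))

  ConditionII : Set
  ConditionII = (n : ℕ) → n ≥ 1 → vLt (b n *ₚ b (suc n)) (+ 0)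

  record Dominant (m : ℕ) : Set where
    field
      vb₁ vb₂ vB₀ vB₁ : ℤ
      b₁-val    : HasVal (b (suc m)) vb₁
      b₂-val    : HasVal (b (suc (suc m))) vb₂
      B₀-val    : HasVal (B b m) vB₀
      B₁-val    : HasVal (B b (suc m)) vB₁
      vB₁≡      : vB₁ ≡ vb₁ ℤ.+ vB₀
      dominance : vb₂ ℤ.+ vB₁ ℤ.< vB₀

  open Dominant

  dominant⇒hasVal-B₂ : ∀ {m} (D : Dominant m) → HasVal (B b (suc (suc m))) (vb₂ D ℤ.+ vB₁ D)
  dominant⇒hasVal-B₂ D =
    hasVal-+ₚ-dominant (hasVal-*ₚ p-prime (b₂-val D) (B₁-val D)) (hasVal⇒vGe (B₀-val D)) (dominance D)

  dominant-zero : ∀ {c₁ c₂} → HasVal (b 1) c₁ → HasVal (b 2) c₂ → c₂ ℤ.+ c₁ ℤ.< 0ℤ → Dominant 0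
  dominant-zero {c₁} {c₂} b₁≈c₁ b₂≈c₂ c₂+c₁<0 = record
    { b₁-val = b₁≈c₁ ; b₂-val = b₂≈c₂ ; B₀-val = hasVal-one p-prime ; B₁-val = b₁≈c₁
    ; vB₁≡ = sym (ℤ.+-identityʳ c₁) ; dominance = c₂+c₁<0 }

  dominant-suc : ∀ {m c} (D : Dominant m) → HasVal (b (suc (suc (suc m)))) c →
                 c ℤ.+ (vb₂ D ℤ.+ vB₁ D) ℤ.< vB₁ D → Dominant (suc m)
  dominant-suc D b₃≈c dominance′ = record
    { b₁-val = b₂-val D ; b₂-val = b₃≈c ; B₀-val = B₁-val D ; B₁-val = dominant⇒hasVal-B₂ D
    ; vB₁≡ = refl ; dominance = dominance′ }

  conditionI⇒dominant : ConditionI → ∀ m → Dominant m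
  conditionI⇒dominant h zero =
    let _ , _ , b₂≈c₂ , b₁≈c₁ , c₂+c₁<0 = vLtv-*ₚ p-prime (b 2) (b 1) (h 1 (s≤s z≤n)) (hasVal-one p-prime)
    in dominant-zero b₁≈c₁ b₂≈c₂ c₂+c₁<0
  conditionI⇒dominant h (suc m) =
    let D = conditionI⇒dominant h m
        c , _ , b₃≈c , B₂≈d , c+d<vB₁ =
          vLtv-*ₚ p-prime (b (suc (suc (suc m)))) (B b (suc (suc m))) (h (suc (suc m)) (s≤s z≤n)) (B₁-val D)
    in dominant-suc D b₃≈c (subst (λ d → c ℤ.+ d ℤ.< vB₁ D) (hasVal-unique B₂≈d (dominant⇒hasVal-B₂ D)) c+d<vB₁)

  conditionII⇒dominant : ConditionII → ∀ m → Dominant m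
  conditionII⇒dominant h zero =
    let c₁ , c₂ , b₁≈c₁ , b₂≈c₂ , c₁+c₂<0 = vLt-*ₚ p-prime (b 1) (b 2) (h 1 (s≤s z≤n))
    in dominant-zero b₁≈c₁ b₂≈c₂ (subst (ℤ._< 0ℤ) (ℤ.+-comm c₁ c₂) c₁+c₂<0)
  conditionII⇒dominant h (suc m) =
    let D = conditionII⇒dominant h m
        c , d , b₂≈c , b₃≈d , c+d<0 =
          vLt-*ₚ p-prime (b (suc (suc m))) (b (suc (suc (suc m)))) (h (suc (suc m)) (s≤s z≤n))
        vb₂+d<0 = subst (λ c → c ℤ.+ d ℤ.< 0ℤ) (hasVal-unique b₂≈c (b₂-val D)) c+d<0
    in dominant-suc D b₃≈d (subst (ℤ._< vB₁ D) (regroup (vb₂ D) d (vB₁ D)) (i<0⇒i+j<j vb₂+d<0))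
    where
    regroup : ∀ c d j → (c ℤ.+ d) ℤ.+ j ≡ d ℤ.+ (c ℤ.+ j)
    regroup = solve-∀

  dominant⇒vLtv : ∀ {m} → Dominant m → vLtv (b (suc (suc m)) *ₚ B b (suc m)) (B b m)
  dominant⇒vLtv D =
    vB₀ D , hasVal⇒vLt (hasVal-*ₚ p-prime (b₂-val D) (B₁-val D)) (dominance D) , hasVal⇒vGe (B₀-val D)

  dominant⇒vLt : ∀ {m} → Dominant m → vLt (b (suc m) *ₚ b (suc (suc m))) 0ℤ
  dominant⇒vLt D = hasVal⇒vLt (hasVal-*ₚ p-prime (b₁-val D) (b₂-val D)) (i+j<j⇒i<0 (begin-strict
    (vb₁ D ℤ.+ vb₂ D) ℤ.+ vB₀ D   ≡⟨ regroup (vb₁ D) (vb₂ D) (vB₀ D) ⟩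
    vb₂ D ℤ.+ (vb₁ D ℤ.+ vB₀ D)   ≡⟨ cong (λ v → vb₂ D ℤ.+ v) (sym (vB₁≡ D)) ⟩
    vb₂ D ℤ.+ vB₁ D               <⟨ dominance D ⟩
    vB₀ D                         ∎))
    where
    open ℤ.≤-Reasoning
    regroup : ∀ c₁ c₂ l → (c₁ ℤ.+ c₂) ℤ.+ l ≡ c₂ ℤ.+ (c₁ ℤ.+ l)
    regroup = solve-∀

  dominant⇒conditionI : (∀ m → Dominant m) → ConditionI
  dominant⇒conditionI D (suc m) _ = dominant⇒vLtv (D m)

  dominant⇒conditionII : (∀ m → Dominant m) → ConditionII
  dominant⇒conditionII D (suc m) _ = dominant⇒vLt (D m)

-- The proof uses only that p is prime, not that it is odd.
theorem3p4 : (p : ℕ) → .{{_ : NonZero p}} → Prime p → p % 2 ≡ 1 →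
    (b : ℕ → ℚₚ p) →
    ((n : ℕ) → n ≥ 1 → vLtv (b (suc n) *ₚ B b n) (B b (n ∸ 1)))
      ⇔ ((n : ℕ) → n ≥ 1 → vLt (b n *ₚ b (suc n)) (+ 0))
theorem3p4 p p-prime _ b =
  mk⇔ (dominant⇒conditionII ∘ conditionI⇒dominant) (dominant⇒conditionI ∘ conditionII⇒dominant)
  where open Continuants p-prime b
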